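{- Let $\omega\in\mathbb{C}\setminus\{0\}$. There is a unique pair of series ${\sf W}(x)\in\mathbb{C}[x][[t]]$ and ${\sf H}(x,y)\in\mathbb{C}[x,y][[t]]$ satisfying \[ {\sf W}(x)=x^2t\,{\sf W}(x)^2+\omega x t\,{\sf H}(x,0)+\omega^{ -1}xt\,{\sf H}(0,x)+1 \] and \[ {\sf H}(x,y)={\sf W}(x){\sf W}(y)+\frac{\omega^{ -1}}{y}\big({\sf H}(x,y)-{\sf H}(x,0)\big)+\frac{\omega}{x}\big({\sf H}(x,y)-{\sf H}(0,y)\big). \] -}

module Defs where

open import Level using (_⊔_)
open import Algebra.Bundles using (CommutativeRing)
open import Data.Nat using (ℕ; zero; suc; _∸_; _≤_)
open import Data.Product using (Σ; ∃; _×_)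
open import Data.Sum using (_⊎_)

-- Formal power series over a commutative ring R, stored by coefficients.
--   Series1 : element of R[x][[t]],   A n i   = [t^n x^i] A
--   Series2 : element of R[x,y][[t]], H n i j = [t^n x^i y^j] H
module _ {c ℓ} (R : CommutativeRing c ℓ) where
  open CommutativeRing R

  Series1 : Set c
  Series1 = ℕ → ℕ → Carrier

  Series2 : Set c
  Series2 = ℕ → ℕ → ℕ → Carrier

  IsPoly1 : Series1 → Set ℓ
  IsPoly1 A = ∀ n → ∃ λ d → ∀ i → d ≤ i → A n i ≈ 0#

  IsPoly2 : Series2 → Set ℓ
  IsPoly2 H = ∀ n → ∃ λ d → ∀ i j → (d ≤ i ⊎ d ≤ j) → H n i j ≈ 0#

  Σ≤ : ℕ → (ℕ → Carrier) → Carrier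
  Σ≤ zero f = f 0
  Σ≤ (suc n) f = Σ≤ n f + f (suc n)

  one1 : Series1
  one1 zero zero = 1#
  one1 _ _ = 0#

  _⊕_ : Series1 → Series1 → Series1
  (A ⊕ B) n i = A n i + B n i

  _·_ : Carrier → Series1 → Series1
  (r · A) n i = r * A n i

  _⊗_ : Series1 → Series1 → Series1
  (A ⊗ B) n i = Σ≤ n λ a → Σ≤ i λ p → A a p * B (n ∸ a) (i ∸ p)

  mulT : Series1 → Series1
  mulT A zero i = 0#
  mulT A (suc n) i = A n i

  mulX : Series1 → Series1
  mulX A n zero = 0#
  mulX A n (suc i) = A n i

  atY0 : Series2 → Series1
  atY0 H n i = H n i 0

  atX0 : Series2 → Series1
  atX0 H n i = H n 0 i

  tensor : Series1 → Series1 → Series2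
  tensor A B n i j = Σ≤ n λ a → A a i * B (n ∸ a) j

  -- (H(x,y) - H(x,0)) / y   and   (H(x,y) - H(0,y)) / x
  divY : Series2 → Series2
  divY H n i j = H n i (suc j)

  divX : Series2 → Series2
  divX H n i j = H n (suc i) j

  EqW : Carrier → Carrier → Series1 → Series2 → Set ℓ
  EqW ω ω⁻¹ W H = ∀ n i → W n i ≈
    (mulT (mulX (mulX (W ⊗ W)))
      ⊕ ((ω · mulT (mulX (atY0 H)))
      ⊕ ((ω⁻¹ · mulT (mulX (atX0 H)))
      ⊕ one1))) n i

  EqH : Carrier → Carrier → Series1 → Series2 → Set ℓ
  EqH ω ω⁻¹ W H = ∀ n i j → H n i j ≈
    (tensor W W n i j + (ω⁻¹ * divY H n i j + ω * divX H n i j))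

  Solution : Carrier → Carrier → Series1 → Series2 → Set ℓ
  Solution ω ω⁻¹ W H = IsPoly1 W × IsPoly2 H × EqW ω ω⁻¹ W H × EqH ω ω⁻¹ W H

-- Existence and uniqueness of the series W ∈ R[x][[t]], H ∈ R[x,y][[t]]
-- solving the coupled system of 'Defs' (over any commutative ring R; the
-- relation ω ω⁻¹ = 1 turns out not to be needed).
--
-- Read the system one power of t at a time.  The t^n coefficient of
-- the W-equation only involves the coefficients of W and H at t^a, a < n.
-- The t^n coefficient H_n of the H-equation is a linear "grid equation"
--   G(i,j) = T(i,j) + ω⁻¹ G(i,j+1) + ω G(i+1,j),    T = [t^n] W(x)W(y),
-- and T only involves W at t^a, a ≤ n.  If T vanishes outside a box
-- [0,d)², the grid equation has exactly one solution vanishing outside a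
-- box: the Picard approximations stabilise, and every such solution equals
-- them (both by a descent on i + j, 'fuelDescent').
module Submission where

open import Defs
import Level
open import Algebra.Bundles using (CommutativeRing)
open import Data.Product using (Σ; _×_; _,_; proj₁; proj₂)
open import Data.Product.Relation.Binary.Pointwise.NonDependent using (_×ₛ_)
open import Data.Sum using (_⊎_; inj₁; inj₂; map₁; map₂)
import Data.Sum as Sum
open import Data.Nat using (ℕ; zero; suc; _∸_; _≤_; _<_; s≤s; _≤′_; ≤′-refl; ≤′-step)
import Data.Nat as ℕ
import Data.Nat.Properties as ℕₚ
open import Data.Nat.Induction using (<-rec)
open import Relation.Nullary using (¬_; yes; no; contradiction)
open import Relation.Binary.Bundles using (Setoid)
open import Function.Indexed.Relation.Binary.Equality using (≡-setoid)
open import Relation.Binary.Indexed.Heterogeneous.Construct.Trivial using (indexedSetoid)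
import Relation.Binary.PropositionalEquality as P

module _ where
  open Data.Nat using (_+_; _*_; _≤?_)
  open ℕₚ
  open P using (_≡_; sym; trans; cong; subst)

  outsideBox : ∀ d i j → d + d ≤ i + j → d ≤ i ⊎ d ≤ j
  outsideBox d i j le with d ≤? i | d ≤? j
  ... | yes d≤i | _       = inj₁ d≤i
  ... | no _    | yes d≤j = inj₂ d≤j
  ... | no d≰i  | no d≰j  = contradiction le (<⇒≱ (+-mono-< (≰⇒> d≰i) (≰⇒> d≰j)))

  fuelDescent : ∀ {p} (Q : ℕ → ℕ → ℕ → Set p) d →
    (∀ i j → d ≤ i ⊎ d ≤ j → Q zero i j) →
    (∀ f i j → Q f i (suc j) → Q f (suc i) j → Q (suc f) i j) →
    ∀ f i j → d + d ≤ i + j + f → Q f i j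
  fuelDescent Q d outside step zero i j le =
    outside i j (outsideBox d i j (subst (d + d ≤_) (+-identityʳ (i + j)) le))
  fuelDescent Q d outside step (suc f) i j le =
    step f i j (fuelDescent Q d outside step f i (suc j) (subst (d + d ≤_) right le))
               (fuelDescent Q d outside step f (suc i) j (subst (d + d ≤_) (+-suc (i + j) f) le))
    where
      right : i + j + suc f ≡ i + suc j + f
      right = trans (+-suc (i + j) f) (sym (cong (_+ f) (+-suc i j)))

  -- In a convolution Σ_k p_k q_{i-k} with deg p ≤ d and d + e < i, every
  -- index k ≤ d leaves i - k beyond the degree e of q.
  convolutionGap : ∀ {d e i k} → ¬ (suc d ≤ k) → suc (d + e) ≤ i → suc e ≤ i ∸ k
  convolutionGap {d} {e} {i} {k} d≮k lt = begin
    suc e               ≡⟨ sym (m+n∸m≡n d (suc e)) ⟩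
    d + suc e ∸ d       ≡⟨ cong (_∸ d) (+-suc d e) ⟩
    suc (d + e) ∸ d     ≤⟨ ∸-monoˡ-≤ d lt ⟩
    i ∸ d               ≤⟨ ∸-monoʳ-≤ i (≤-pred (≰⇒> d≮k)) ⟩
    i ∸ k               ∎
    where open ≤-Reasoning

  -- deg_x [t^n] W ≤ 2n: the bound that the system propagates.
  degBound : ℕ → ℕ
  degBound n = 2 * n

  degBound-mono : ∀ {a n} → a ≤ n → degBound a ≤ degBound n
  degBound-mono = *-monoʳ-≤ 2

  degBound-split : ∀ {a n} → a ≤ n → degBound a + degBound (n ∸ a) ≡ degBound n
  degBound-split {a} {n} a≤n =
    trans (sym (*-distribˡ-+ 2 a (n ∸ a))) (cong (2 *_) (m+[n∸m]≡n a≤n))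

  degBound-suc : ∀ n → degBound (suc n) ≡ suc (suc (degBound n))
  degBound-suc n = *-suc 2 n

AgreeBelow : ∀ {a r} {A : Set a} → (A → A → Set r) → ℕ → (ℕ → A) → (ℕ → A) → Set r
AgreeBelow _~_ m x y = ∀ n → n < m → x n ~ y n

agreeBelow-extend : ∀ {a r} {A : Set a} {_~_ : A → A → Set r} {m x y} →
  AgreeBelow _~_ m x y → x m ~ y m → AgreeBelow _~_ (suc m) x y
agreeBelow-extend below here n (s≤s n≤m) with ℕₚ.m≤n⇒m<n∨m≡n n≤m
... | inj₁ n<m    = below n n<m
... | inj₂ P.refl = here

-- A causal operator on sequences (level n of the output only depends on
-- levels < n of the input) has a fixed point: the iterates of any seed agree
-- with each other below level k from the k-th iterate on, and the diagonal
-- sequence of these settled values is fixed.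
module CausalFixedPoint {a r} (S : Setoid a r) where
  open Setoid S

  Causal : ((ℕ → Carrier) → (ℕ → Carrier)) → Set (Level._⊔_ a r)
  Causal Φ = ∀ m x y → AgreeBelow _≈_ m x y → AgreeBelow _≈_ (suc m) (Φ x) (Φ y)

  module _ (Φ : (ℕ → Carrier) → (ℕ → Carrier)) (causal : Causal Φ) (seed : ℕ → Carrier) where

    iterate : ℕ → ℕ → Carrier
    iterate zero    = seed
    iterate (suc k) = Φ (iterate k)

    iterate-settles : ∀ k → AgreeBelow _≈_ k (iterate k) (iterate (suc k))
    iterate-settles zero    n ()
    iterate-settles (suc k) = causal k _ _ (iterate-settles k)

    iterate-stable : ∀ {k l} → k ≤′ l → AgreeBelow _≈_ k (iterate k) (iterate l)
    iterate-stable ≤′-refl n n<k = refl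
    iterate-stable (≤′-step {l} k≤′l) n n<k =
      trans (iterate-stable k≤′l n n<k)
            (iterate-settles l n (ℕₚ.≤-trans n<k (ℕₚ.≤′⇒≤ k≤′l)))

    -- Level n of the limit is read off the first iterate where it settles.
    limit : ℕ → Carrier
    limit n = iterate (suc n) n

    iterate-limit : ∀ k → AgreeBelow _≈_ k (iterate k) limit
    iterate-limit k n n<k = sym (iterate-stable (ℕₚ.≤⇒≤′ n<k) n ℕₚ.≤-refl)

    limit-fixed : ∀ n → limit n ≈ Φ limit n
    limit-fixed n = causal n _ _ (iterate-limit n) n ℕₚ.≤-refl

module PowerSeries {c ℓ} (R : CommutativeRing c ℓ) where
  open CommutativeRing R

  -- t-coefficients of series in R[x][[t]] and R[x,y][[t]].
  Poly : Set c
  Poly = ℕ → Carrier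

  Grid : Set c
  Grid = ℕ → ℕ → Carrier

  polySetoid : Setoid c ℓ
  polySetoid = ≡-setoid ℕ (indexedSetoid setoid)

  gridSetoid : Setoid c ℓ
  gridSetoid = ≡-setoid ℕ (indexedSetoid polySetoid)

  _≈₁_ : Poly → Poly → Set ℓ
  _≈₁_ = Setoid._≈_ polySetoid

  _≈₂_ : Grid → Grid → Set ℓ
  _≈₂_ = Setoid._≈_ gridSetoid

  Agree₁ : ℕ → Series1 R → Series1 R → Set ℓ
  Agree₁ = AgreeBelow _≈₁_

  Agree₂ : ℕ → Series2 R → Series2 R → Set ℓ
  Agree₂ = AgreeBelow _≈₂_

  VanishesFrom : ℕ → Poly → Set ℓ
  VanishesFrom d p = ∀ i → d ≤ i → p i ≈ 0#

  VanishesOutside : ℕ → Grid → Set ℓ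
  VanishesOutside d G = ∀ i j → d ≤ i ⊎ d ≤ j → G i j ≈ 0#

  vanishesOutside-mono : ∀ {d d' G} → d ≤ d' → VanishesOutside d G → VanishesOutside d' G
  vanishesOutside-mono d≤d' G-van i j out =
    G-van i j (Sum.map (ℕₚ.≤-trans d≤d') (ℕₚ.≤-trans d≤d') out)

  scale-zero : ∀ r {x} → x ≈ 0# → r * x ≈ 0#
  scale-zero r x≈0 = trans (*-cong refl x≈0) (zeroʳ r)

  sum-zero : ∀ {x y} → x ≈ 0# → y ≈ 0# → x + y ≈ 0#
  sum-zero x≈0 y≈0 = trans (+-cong x≈0 y≈0) (+-identityʳ 0#)

  Σ≤-cong : ∀ n {f g : ℕ → Carrier} → (∀ k → k ≤ n → f k ≈ g k) → Σ≤ R n f ≈ Σ≤ R n g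
  Σ≤-cong zero    f≈g = f≈g 0 ℕ.z≤n
  Σ≤-cong (suc n) f≈g =
    +-cong (Σ≤-cong n (λ k k≤n → f≈g k (ℕₚ.m≤n⇒m≤1+n k≤n))) (f≈g (suc n) ℕₚ.≤-refl)

  Σ≤-zero : ∀ n {f : ℕ → Carrier} → (∀ k → k ≤ n → f k ≈ 0#) → Σ≤ R n f ≈ 0#
  Σ≤-zero zero    f≈0 = f≈0 0 ℕ.z≤n
  Σ≤-zero (suc n) f≈0 =
    sum-zero (Σ≤-zero n (λ k k≤n → f≈0 k (ℕₚ.m≤n⇒m≤1+n k≤n))) (f≈0 (suc n) ℕₚ.≤-refl)

  -- Product of polynomials in x; the t^n x^i coefficient of A ⊗ B is
  -- Σ_{a ≤ n} conv (A a) (B (n - a)) i.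
  conv : Poly → Poly → Poly
  conv p q i = Σ≤ R i λ k → p k * q (i ∸ k)

  conv-cong : ∀ {p p' q q'} → p ≈₁ p' → q ≈₁ q' → conv p q ≈₁ conv p' q'
  conv-cong p≈ q≈ i = Σ≤-cong i λ k _ → *-cong (p≈ k) (q≈ (i ∸ k))

  conv-degree : ∀ {d e p q} → VanishesFrom (suc d) p → VanishesFrom (suc e) q →
    VanishesFrom (suc (d ℕ.+ e)) (conv p q)
  conv-degree {d} {e} {p} {q} p-deg q-deg i lt = Σ≤-zero i term
    where
      term : ∀ k → k ≤ i → p k * q (i ∸ k) ≈ 0#
      term k _ with suc d ℕ.≤? k
      ... | yes d<k = trans (*-cong (p-deg k d<k) refl) (zeroˡ _)
      ... | no d≮k  = scale-zero (p k) (q-deg (i ∸ k) (convolutionGap d≮k lt))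

  DegreesUpTo : ℕ → Series1 R → Set ℓ
  DegreesUpTo n A = ∀ a → a ≤ n → VanishesFrom (suc (degBound a)) (A a)

  ⊗-degree : ∀ {n A B} → DegreesUpTo n A → DegreesUpTo n B →
    VanishesFrom (suc (degBound n)) (_⊗_ R A B n)
  ⊗-degree {n} A-deg B-deg i lt = Σ≤-zero n λ a a≤n →
    conv-degree (A-deg a a≤n) (B-deg (n ∸ a) (ℕₚ.m∸n≤m n a)) i
      (P.subst (λ d → suc d ≤ i) (P.sym (degBound-split a≤n)) lt)

  tensor-degree : ∀ {n A B} → DegreesUpTo n A → DegreesUpTo n B →
    VanishesOutside (suc (degBound n)) (tensor R A B n)
  tensor-degree {n} A-deg B-deg i j (inj₁ lt) = Σ≤-zero n λ a a≤n →
    trans (*-cong (A-deg a a≤n i (ℕₚ.≤-trans (s≤s (degBound-mono a≤n)) lt)) refl) (zeroˡ _)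
  tensor-degree {n} A-deg B-deg i j (inj₂ lt) = Σ≤-zero n λ a a≤n →
    scale-zero _ (B-deg (n ∸ a) (ℕₚ.m∸n≤m n a) j
      (ℕₚ.≤-trans (s≤s (degBound-mono (ℕₚ.m∸n≤m n a))) lt))

  ⊗-cong : ∀ {m A A' B B'} → Agree₁ m A A' → Agree₁ m B B' →
    Agree₁ m (_⊗_ R A B) (_⊗_ R A' B')
  ⊗-cong A≈ B≈ n n<m i = Σ≤-cong n λ a a≤n →
    conv-cong (A≈ a (ℕₚ.≤-<-trans a≤n n<m)) (B≈ (n ∸ a) (ℕₚ.≤-<-trans (ℕₚ.m∸n≤m n a) n<m)) i

  tensor-cong : ∀ {m A A' B B'} → Agree₁ m A A' → Agree₁ m B B' →
    Agree₂ m (tensor R A B) (tensor R A' B')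
  tensor-cong A≈ B≈ n n<m i j = Σ≤-cong n λ a a≤n →
    *-cong (A≈ a (ℕₚ.≤-<-trans a≤n n<m) i) (B≈ (n ∸ a) (ℕₚ.≤-<-trans (ℕₚ.m∸n≤m n a) n<m) j)

  mulX-cong : ∀ {A B : Series1 R} n → A n ≈₁ B n → mulX R A n ≈₁ mulX R B n
  mulX-cong n A≈B zero    = refl
  mulX-cong n A≈B (suc i) = A≈B i

  -- The t^n coefficient of the H-equation:
  --   G(i,j) = T(i,j) + ω⁻¹ G(i,j+1) + ω G(i+1,j).
  module GridEquation (ω ω⁻¹ : Carrier) where

    GridEq : Grid → Grid → Set ℓ
    GridEq T G = ∀ i j → G i j ≈ T i j + (ω⁻¹ * G i (suc j) + ω * G (suc i) j)

    gridEq-resp : ∀ {T G G'} → G ≈₂ G' → GridEq T G → GridEq T G'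
    gridEq-resp G≈G' G-eq i j =
      trans (sym (G≈G' i j))
        (trans (G-eq i j) (+-cong refl (+-cong (*-cong refl (G≈G' i (suc j)))
                                               (*-cong refl (G≈G' (suc i) j)))))

    approx : Grid → ℕ → Grid
    approx T zero    i j = 0#
    approx T (suc f) i j = T i j + (ω⁻¹ * approx T f i (suc j) + ω * approx T f (suc i) j)

    approx-cong : ∀ {T T'} → T ≈₂ T' → ∀ f → approx T f ≈₂ approx T' f
    approx-cong T≈ zero    i j = refl
    approx-cong T≈ (suc f) i j =
      +-cong (T≈ i j) (+-cong (*-cong refl (approx-cong T≈ f i (suc j)))
                              (*-cong refl (approx-cong T≈ f (suc i) j)))

    approx-vanishes : ∀ {d T} → VanishesOutside d T → ∀ f → VanishesOutside d (approx T f)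
    approx-vanishes T-van zero    i j out = refl
    approx-vanishes T-van (suc f) i j out =
      sum-zero (T-van i j out)
        (sum-zero (scale-zero ω⁻¹ (approx-vanishes T-van f i (suc j) (map₂ ℕₚ.m≤n⇒m≤1+n out)))
                  (scale-zero ω (approx-vanishes T-van f (suc i) j (map₁ ℕₚ.m≤n⇒m≤1+n out))))

    approx-settles : ∀ {d T} → VanishesOutside d T →
      ∀ f i j → d ℕ.+ d ≤ i ℕ.+ j ℕ.+ f → approx T (suc f) i j ≈ approx T f i j
    approx-settles {d} {T} T-van = fuelDescent (λ f i j → approx T (suc f) i j ≈ approx T f i j) d
      (approx-vanishes T-van 1)
      (λ f i j below right → +-cong refl (+-cong (*-cong refl below) (*-cong refl right)))

    solution-is-approx : ∀ {d T G} → GridEq T G → VanishesOutside d G →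
      ∀ f i j → d ℕ.+ d ≤ i ℕ.+ j ℕ.+ f → G i j ≈ approx T f i j
    solution-is-approx {d} {T} {G} G-eq G-van = fuelDescent (λ f i j → G i j ≈ approx T f i j) d G-van
      (λ f i j below right →
        trans (G-eq i j) (+-cong refl (+-cong (*-cong refl below) (*-cong refl right))))

    gridSolution : Grid → ℕ → Grid
    gridSolution T d = approx T (suc (d ℕ.+ d))

    gridSolution-cong : ∀ d {T T'} → T ≈₂ T' → gridSolution T d ≈₂ gridSolution T' d
    gridSolution-cong d T≈T' = approx-cong T≈T' (suc (d ℕ.+ d))

    gridSolution-vanishes : ∀ {d T} → VanishesOutside d T → VanishesOutside d (gridSolution T d)
    gridSolution-vanishes {d} T-van = approx-vanishes T-van (suc (d ℕ.+ d))

    gridSolution-solves : ∀ {d T} → VanishesOutside d T → GridEq T (gridSolution T d)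
    gridSolution-solves {d} {T} T-van i j =
      +-cong refl (+-cong (*-cong refl (sym (settled i (suc j)))) (*-cong refl (sym (settled (suc i) j))))
      where
        settled : ∀ i j → approx T (suc (d ℕ.+ d)) i j ≈ approx T (d ℕ.+ d) i j
        settled i j = approx-settles T-van (d ℕ.+ d) i j (ℕₚ.m≤n+m (d ℕ.+ d) (i ℕ.+ j))

    grid-unique : ∀ {d d' T T' G G'} → GridEq T G → GridEq T' G' → T ≈₂ T' →
      VanishesOutside d G → VanishesOutside d' G' → G ≈₂ G'
    grid-unique {d} {d'} {T} {T'} {G} {G'} G-eq G'-eq T≈T' G-van G'-van i j = begin
      G i j            ≈⟨ solution-is-approx G-eq (enlarge (ℕₚ.m≤m⊔n d d') G-van) F i j fuel ⟩
      approx T F i j   ≈⟨ approx-cong T≈T' F i j ⟩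
      approx T' F i j  ≈⟨ sym (solution-is-approx G'-eq (enlarge (ℕₚ.m≤n⊔m d d') G'-van) F i j fuel) ⟩
      G' i j           ∎
      where
        open import Relation.Binary.Reasoning.Setoid setoid
        D : ℕ
        D = ℕ._⊔_ d d'
        enlarge : ∀ {e G} → e ≤ D → VanishesOutside e G → VanishesOutside D G
        enlarge = vanishesOutside-mono
        F : ℕ
        F = D ℕ.+ D
        fuel : F ≤ i ℕ.+ j ℕ.+ F
        fuel = ℕₚ.m≤n+m F (i ℕ.+ j)

  module System (ω ω⁻¹ : Carrier) where
    open GridEquation ω ω⁻¹

    stepW : Series1 R → Series2 R → Series1 R
    stepW W H = _⊕_ R (mulT R (mulX R (mulX R (_⊗_ R W W))))
                  (_⊕_ R (_·_ R ω (mulT R (mulX R (atY0 R H))))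
                    (_⊕_ R (_·_ R ω⁻¹ (mulT R (mulX R (atX0 R H)))) (one1 R)))

    -- The finitely supported solution of the H-equation at each level,
    -- assuming deg_x W_a ≤ 2a.
    solveH : Series1 R → Series2 R
    solveH W n = gridSolution (tensor R W W n) (suc (degBound n))

    stepW-cong : ∀ {m W W' H H'} → Agree₁ m W W' → Agree₂ m H H' →
      Agree₁ (suc m) (stepW W H) (stepW W' H')
    stepW-cong W≈ H≈ zero    _         i = refl
    stepW-cong W≈ H≈ (suc n) (s≤s n<m) i =
      +-cong (mulX-cong n (mulX-cong n (⊗-cong W≈ W≈ n n<m)) i)
        (+-cong (*-cong refl (mulX-cong n (λ k → H≈ n n<m k 0) i))
          (+-cong (*-cong refl (mulX-cong n (λ k → H≈ n n<m 0 k) i)) refl))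

    solveH-cong : ∀ {m V V'} → Agree₁ m V V' → Agree₂ m (solveH V) (solveH V')
    solveH-cong V≈ n n<m = gridSolution-cong (suc (degBound n)) (tensor-cong V≈ V≈ n n<m)

    solveH-solves : ∀ {n V} → DegreesUpTo n V → GridEq (tensor R V V n) (solveH V n)
    solveH-solves V-deg = gridSolution-solves (tensor-degree V-deg V-deg)

    solveH-vanishes : ∀ {n V} → DegreesUpTo n V → VanishesOutside (suc (degBound n)) (solveH V n)
    solveH-vanishes V-deg = gridSolution-vanishes (tensor-degree V-deg V-deg)

    stepW-degree₀ : ∀ {W H} → VanishesFrom 1 (stepW W H 0)
    stepW-degree₀ (suc i) _ =
      sum-zero refl (sum-zero (scale-zero ω refl) (sum-zero (scale-zero ω⁻¹ refl) refl))

    stepW-degree : ∀ {W H} n → DegreesUpTo n W → VanishesOutside (suc (degBound n)) (H n) →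
      VanishesFrom (suc (degBound (suc n))) (stepW W H (suc n))
    stepW-degree {W} {H} n W-deg H-van i lt = peel i (P.subst (_< i) (degBound-suc n) lt)
      where
        peel : ∀ i → suc (suc (degBound n)) < i → stepW W H (suc n) i ≈ 0#
        peel zero          ()
        peel (suc zero)    (s≤s ())
        peel (suc (suc i)) (s≤s (s≤s lt)) =
          sum-zero (⊗-degree W-deg W-deg i lt)
            (sum-zero (scale-zero ω (H-van (suc i) 0 (inj₁ (ℕₚ.m≤n⇒m≤1+n lt))))
              (sum-zero (scale-zero ω⁻¹ (H-van 0 (suc i) (inj₂ (ℕₚ.m≤n⇒m≤1+n lt)))) refl))

    levelSetoid : Setoid c ℓ
    levelSetoid = polySetoid ×ₛ gridSetoid

    open CausalFixedPoint levelSetoid using (Causal; limit; limit-fixed)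

    components₁ : (ℕ → Poly × Grid) → Series1 R
    components₁ x n = proj₁ (x n)

    components₂ : (ℕ → Poly × Grid) → Series2 R
    components₂ x n = proj₂ (x n)

    Φ : (ℕ → Poly × Grid) → (ℕ → Poly × Grid)
    Φ x n = stepW W H n , solveH (stepW W H) n
      where
        W : Series1 R
        W = components₁ x
        H : Series2 R
        H = components₂ x

    Φ-causal : Causal Φ
    Φ-causal m x y x≈y n n<m = stepW-cong W≈ H≈ n n<m , solveH-cong (stepW-cong W≈ H≈) n n<m
      where
        W≈ : Agree₁ m (components₁ x) (components₁ y)
        W≈ a a<m = proj₁ (x≈y a a<m)
        H≈ : Agree₂ m (components₂ x) (components₂ y)
        H≈ a a<m = proj₂ (x≈y a a<m)

    fixedPoint : Σ (Series1 R) λ W → Σ (Series2 R) λ H →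
      (∀ n → W n ≈₁ stepW W H n) × (∀ n → H n ≈₂ solveH W n)
    fixedPoint = W , H , W-fixed , H-fixed
      where
        x : ℕ → Poly × Grid
        x = limit Φ Φ-causal (λ _ → (λ _ → 0#) , (λ _ _ → 0#))
        W : Series1 R
        W = components₁ x
        H : Series2 R
        H = components₂ x
        W-fixed : ∀ n → W n ≈₁ stepW W H n
        W-fixed n = proj₁ (limit-fixed Φ Φ-causal _ n)
        H-fixed : ∀ n → H n ≈₂ solveH W n
        H-fixed n i j = trans (proj₂ (limit-fixed Φ Φ-causal _ n) i j)
          (solveH-cong (λ a _ k → sym (W-fixed a k)) n ℕₚ.≤-refl i j)

    -- A fixed point solves the system: by induction deg_x W_n ≤ 2n, which
    -- makes solveH W the solution of the H-equation.
    fixed-solves : ∀ {W H} → (∀ n → W n ≈₁ stepW W H n) → (∀ n → H n ≈₂ solveH W n) →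
      Solution R ω ω⁻¹ W H
    fixed-solves {W} {H} W-fixed H-fixed =
      (λ n → suc (degBound n) , W-degree n) , (λ n → suc (degBound n) , H-vanishes (degreesUpTo n)) ,
      W-fixed , (λ n → gridEq-resp (λ i j → sym (H-fixed n i j)) (solveH-solves (degreesUpTo n)))
      where
        H-vanishes : ∀ {n} → DegreesUpTo n W → VanishesOutside (suc (degBound n)) (H n)
        H-vanishes W-deg i j out = trans (H-fixed _ i j) (solveH-vanishes W-deg i j out)

        W-degree : ∀ n → VanishesFrom (suc (degBound n)) (W n)
        W-degree = <-rec _ level
          where
            level : ∀ n → (∀ {a} → a < n → VanishesFrom (suc (degBound a)) (W a)) →
              VanishesFrom (suc (degBound n)) (W n)
            level zero    _     i lt = trans (W-fixed 0 i) (stepW-degree₀ {W} {H} i lt)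
            level (suc m) below i lt =
              trans (W-fixed (suc m) i) (stepW-degree {W} {H} m W-deg (H-vanishes W-deg) i lt)
              where
                W-deg : DegreesUpTo m W
                W-deg a a≤m = below (s≤s a≤m)

        degreesUpTo : ∀ n → DegreesUpTo n W
        degreesUpTo n a _ = W-degree a

    -- Two solutions agree, by strong induction on the level: the W-equation
    -- determines W_n from lower levels, then the grid equation determines H_n.
    solutions-agree : ∀ {W H W' H'} → Solution R ω ω⁻¹ W H → Solution R ω ω⁻¹ W' H' →
      ∀ n → W n ≈₁ W' n × H n ≈₂ H' n
    solutions-agree {W} {H} {W'} {H'} (_ , H-poly , W-eq , H-eq) (_ , H'-poly , W'-eq , H'-eq) =
      <-rec _ level
      where
        level : ∀ n → (∀ {a} → a < n → W a ≈₁ W' a × H a ≈₂ H' a) → W n ≈₁ W' n × H n ≈₂ H' n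
        level n below = Wₙ , Hₙ
          where
            W-below : Agree₁ n W W'
            W-below a a<n = proj₁ (below a<n)
            H-below : Agree₂ n H H'
            H-below a a<n = proj₂ (below a<n)
            Wₙ : W n ≈₁ W' n
            Wₙ i = trans (W-eq n i)
                     (trans (stepW-cong {H = H} {H'} W-below H-below n ℕₚ.≤-refl i) (sym (W'-eq n i)))
            Hₙ : H n ≈₂ H' n
            Hₙ = grid-unique (H-eq n) (H'-eq n) (tensor-cong W-upTo W-upTo n ℕₚ.≤-refl)
                   (proj₂ (H-poly n)) (proj₂ (H'-poly n))
              where
                W-upTo : Agree₁ (suc n) W W'
                W-upTo = agreeBelow-extend {_~_ = _≈₁_} W-below Wₙ

mainTheorem3 : ∀ {c ℓ} (R : CommutativeRing c ℓ) → let open CommutativeRing R in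
    (ω ω⁻¹ : Carrier) → ω * ω⁻¹ ≈ 1# →
    Σ (Series1 R) λ W → Σ (Series2 R) λ H →
      Solution R ω ω⁻¹ W H ×
      (∀ W′ H′ → Solution R ω ω⁻¹ W′ H′ →
        (∀ n i → W′ n i ≈ W n i) × (∀ n i j → H′ n i j ≈ H n i j))
mainTheorem3 R ω ω⁻¹ _ = W , H , solves , unique
  where
    open CommutativeRing R using (_≈_)
    open PowerSeries.System R ω ω⁻¹

    W : Series1 R
    W = proj₁ fixedPoint

    H : Series2 R
    H = proj₁ (proj₂ fixedPoint)

    solves : Solution R ω ω⁻¹ W H
    solves = fixed-solves (proj₁ (proj₂ (proj₂ fixedPoint))) (proj₂ (proj₂ (proj₂ fixedPoint)))

    unique : ∀ W′ H′ → Solution R ω ω⁻¹ W′ H′ →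
      (∀ n i → W′ n i ≈ W n i) × (∀ n i j → H′ n i j ≈ H n i j)
    unique W′ H′ s′ = (λ n → proj₁ (solutions-agree s′ solves n)) , (λ n → proj₂ (solutions-agree s′ solves n))
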